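{- Let $n,s,d\in\mathbb{N}$ with $n\ge sd$ and $n$ divisible by $s$, let $\mathcal{S}$ be a set of size $s$ and $G$ an Abelian group. If $P\in\mathcal{J}_d(\mathcal{S}^n,G)$ satisfies $P(\mathbf{a})\ne0$ for some $\mathbf{a}\in\mathcal{S}^n_\mu$, then $$\Pr_{\mathbf{x}\sim\mathcal{S}^n_\mu}[P(\mathbf{x})\ne0]\ \ge\ \frac{1}{(sd)^{sd}},$$ where $\mathbf{x}$ is uniform on $\mathcal{S}^n_\mu$.
   Context: $\mathcal{S}^n_\mu$ is the set of $\mathbf{a}\in\mathcal{S}^n$ in which every element of $\mathcal{S}$ appears exactly $n/s$ times. $\mathcal{J}_d(\mathcal{S}^n,G)$ is the set of functions $\mathcal{S}^n\to G$ that are sums of $d$-juntas (functions depending on at most $d$ coordinates). -}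

module Defs where

open import Level using (Level)
open import Data.Nat using (ℕ; zero; suc; _*_; _≤_)
import Data.Nat as ℕ
open import Data.Fin using (Fin)
import Data.Fin.Properties as FinP
open import Data.Vec using (Vec; []; _∷_; lookup; count)
open import Data.List using (List; []; _∷_; length; map; concatMap; foldr; filter)
open import Data.List.Membership.Propositional using (_∈_)
open import Data.List.Relation.Unary.Unique.Propositional using (Unique)
open import Data.Product using (Σ; _×_; ∃; ∃-syntax)
open import Relation.Binary.PropositionalEquality using (_≡_)
open import Relation.Nullary using (¬_; Dec)
open import Relation.Unary using (Decidable)
open import Algebra.Bundles using (AbelianGroup)

allVecs : (s n : ℕ) → List (Vec (Fin s) n)
allVecs s zero    = [] ∷ []
allVecs s (suc n) =
  concatMap (λ c → map (c ∷_) (allVecs s n)) (Data.List.allFin s)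
  where import Data.List

occ : {s n : ℕ} → Fin s → Vec (Fin s) n → ℕ
occ c x = count (FinP._≟ c) x

-- x ∈ S^n_μ : every element of S appears exactly n/s times
-- (stated as s * occ c x ≡ n, equivalent to occ c x ≡ n / s when s ∣ n, s > 0).
Balanced : {s n : ℕ} → Vec (Fin s) n → Set
Balanced {s} {n} x = (c : Fin s) → s * occ c x ≡ n

balanced? : {s n : ℕ} → Decidable (Balanced {s} {n})
balanced? {s} {n} x = FinP.all? (λ c → s * occ c x ℕ.≟ n)

slice : (s n : ℕ) → List (Vec (Fin s) n)
slice s n = filter balanced? (allVecs s n)

module _ {c ℓ : Level} (G : AbelianGroup c ℓ) where
  open AbelianGroup G renaming (Carrier to A)

  gsum : List A → A
  gsum = foldr _∙_ ε

  IsJunta : {s n : ℕ} → ℕ → (Vec (Fin s) n → A) → Set ℓ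
  IsJunta {s} {n} d f =
    Σ (List (Fin n)) λ T → length T ≤ d ×
      ((x y : Vec (Fin s) n) →
        ((i : Fin n) → i ∈ T → lookup x i ≡ lookup y i) → f x ≈ f y)

  InJ : {s n : ℕ} → ℕ → (Vec (Fin s) n → A) → Set (c Level.⊔ ℓ)
  InJ {s} {n} d P =
    Σ (List (Vec (Fin s) n → A)) λ fs →
      ((f : Vec (Fin s) n → A) → f ∈ fs → IsJunta d f) ×
      ((x : Vec (Fin s) n) → P x ≈ gsum (map (λ f → f x) fs))

{-# OPTIONS --safe #-}
-- Write B = s * d. Call a partial assignment ρ of the coordinates together with a profile κ
-- (the number of free coordinates carrying each symbol) a restricted slice; by the multinomial
-- formula it has F! / ∏ κ_c! points, F being the number of free coordinates. By induction on e:
-- if P is a sum of functions each depending on at most e free coordinates and P ≠ 0 somewhere on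
-- the restricted slice, then the slice has at most (B * B)^e times as many points as the support
-- of P in it. The slice is connected by transpositions of free coordinates, so either P vanishes
-- nowhere on it, or P y ≠ P (y ∘ (i j)) for some point y and free coordinates i, j. Then
-- y_i ≠ y_j, and e ≥ 1 because juntas of free degree 0 are invariant under such transpositions.
-- Fixing i and j to y_i and y_j, the derivative P - P ∘ (i j) has free degree e - 1; its support
-- injects into that of P (via x ↦ x or x ↦ x ∘ (i j)), and fixing the two coordinates shrinks
-- the slice by a factor of at most B * B, because every symbol that still occurs fills at least
-- a 1/B fraction of the free coordinates. Finally (B * B)^d ≤ B^B when s ≥ 2, and for s ≤ 1
-- the slice has at most one point.
-- Equality in G is not decidable, so the argument runs under a double negation, which the
-- conclusion, an inequality of natural numbers, absorbs.
module Submission where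

open import Algebra.Bundles using (AbelianGroup)
open import Data.Bool using (true; false)
open import Data.Fin using (Fin; zero; suc; punchIn)
open import Data.Fin.Permutation as Perm using ()
open import Data.Fin.Permutation.Components using (transpose)
open import Data.Fin.Properties using (_≟_; punchInᵢ≢i; all?; any?)
open import Data.List using (List; []; _∷_; length; map; filter; _++_; tabulate; concatMap; allFin;
                             cartesianProductWith; removeAt)
open import Data.List.Membership.Propositional using (_∈_)
open import Data.List.Membership.Propositional.Properties
  using (∈-length; ∈-filter⁻; ∈-filter⁺; ∈-map⁻; ∈-map⁺; ∈-++⁺ˡ; ∈-++⁺ʳ)
import Data.List.Membership.DecPropositional as DecMembership
open import Data.List.Properties
  using (length-filter; length-removeAt′; filter-notAll; filter-≐; filter-none; filter-accept; filter-++;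
         length-++; length-map; length-tabulate)
open import Data.List.Relation.Binary.Subset.Propositional using (_⊆_)
open import Data.List.Relation.Unary.All as All using ()
open import Data.List.Relation.Unary.Any as Any using (here; there; index)
open import Data.List.Relation.Unary.Unique.Propositional using (Unique; []; _∷_)
open import Data.List.Relation.Unary.Unique.Propositional.Properties
  using (cartesianProductWith⁺; allFin⁺; filter⁺)
open import Data.Maybe using (Maybe; just; nothing)
import Data.Nat as ℕ
open import Data.Nat
  using (ℕ; zero; suc; _+_; _*_; _∸_; _^_; _!; _≤_; _<_; _≤?_; z≤n; s≤s; NonZero; >-nonZero)
open import Data.Nat.Divisibility using (_∣_; divides)
open import Data.Nat.Induction using (<-wellFounded)
open import Data.Nat.Properties hiding (_≟_)
open import Data.Product using (Σ; ∃; _×_; _,_; proj₁; proj₂; uncurry)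
open import Data.Sum using (_⊎_; inj₁; inj₂; [_,_])
open import Data.Unit using (⊤; tt)
open import Data.Vec as Vec using (Vec; []; _∷_; lookup; _[_]≔_; _[_]=_)
import Data.Vec.Properties as Vecₚ
import Data.Vec.Relation.Binary.Pointwise.Extensional as Pointwise
open import Defs
open import Function using (_∘_; id)
open import Induction.WellFounded using (Acc; acc)
open import Level using (Level; 0ℓ; _⊔_)
open import Relation.Binary.Construct.Closure.ReflexiveTransitive as Star using (Star; _◅_)
open import Relation.Binary.PropositionalEquality
  using (_≡_; _≢_; refl; sym; trans; cong; cong₂; subst; subst₂; module ≡-Reasoning)
open import Relation.Nullary using (¬_; Dec; yes; no; does; contradiction; _×-dec_; _⊎-dec_; ¬?)
open import Relation.Nullary.Decidable using (dec-true; dec-false; map′; decidable-stable)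
open import Relation.Unary using (Pred; Decidable; _≐_)

open import Algebra.Properties.CommutativeSemigroup +-commutativeSemigroup using (xy∙z≈zy∙x)
open import Algebra.Properties.CommutativeSemigroup *-commutativeSemigroup
  using () renaming (x∙yz≈y∙xz to x*[y*z]≡y*[x*z]; xy∙z≈xz∙y to x*y*z≡x*z*y)
open import Algebra.Properties.Semiring.Sum +-*-semiring
  using (sum; sum-syntax; sum-remove; sum-cong-≗; sum-replicate-zero; ∑-distrib-+; ∑-comm; ∑-permute;
         *-distribʳ-sum)
open import Algebra.Properties.CommutativeMonoid.Sum *-1-commutativeMonoid
  using () renaming (sum to product; sum-remove to product-remove; sum-cong-≗ to product-cong-≗;
                     sum-replicate-zero to product-replicate-one)

private variable
  a p q : Level
  A A′ : Set a

-- Finite sums and lists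

𝟙 : {P : Set p} → Dec P → ℕ
𝟙 (yes _) = 1
𝟙 (no _)  = 0

𝟙-yes : {P : Set p} (P? : Dec P) → P → 𝟙 P? ≡ 1
𝟙-yes (yes _) _  = refl
𝟙-yes (no ¬p) pf = contradiction pf ¬p

𝟙-no : {P : Set p} (P? : Dec P) → ¬ P → 𝟙 P? ≡ 0
𝟙-no (yes pf) ¬p = contradiction pf ¬p
𝟙-no (no _)   _  = refl

𝟙≤1 : {P : Set p} (P? : Dec P) → 𝟙 P? ≤ 1
𝟙≤1 (yes _) = ≤-refl
𝟙≤1 (no _)  = z≤n

∑-const : ∀ n m → ∑[ k < n ] m ≡ n * m
∑-const zero    m = refl
∑-const (suc n) m = cong (m +_) (∑-const n m)

∑≡0⇒≡0 : ∀ {n} (f : Fin n → ℕ) → sum f ≡ 0 → ∀ k → f k ≡ 0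
∑≡0⇒≡0 f ∑f≡0 zero    = m+n≡0⇒m≡0 (f zero) ∑f≡0
∑≡0⇒≡0 f ∑f≡0 (suc k) = ∑≡0⇒≡0 (f ∘ suc) (m+n≡0⇒n≡0 (f zero) ∑f≡0) k

∑-indicator : ∀ {n} (i : Fin n) → ∑[ k < n ] 𝟙 (i ≟ k) ≡ 1
∑-indicator {suc n} i = begin
  ∑[ k < suc n ] 𝟙 (i ≟ k)                    ≡⟨ sum-remove {i = i} (λ k → 𝟙 (i ≟ k)) ⟩
  𝟙 (i ≟ i) + ∑[ k < n ] 𝟙 (i ≟ punchIn i k)  ≡⟨ cong₂ _+_ (𝟙-yes (i ≟ i) refl) (sum-cong-≗ others) ⟩
  1 + ∑[ k < n ] 0                             ≡⟨ cong suc (sum-replicate-zero n) ⟩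
  1                                            ∎
  where
  open ≡-Reasoning
  others : ∀ k → 𝟙 (i ≟ punchIn i k) ≡ 0
  others k = 𝟙-no (i ≟ punchIn i k) (punchInᵢ≢i i k ∘ sym)

∑-mono-≤ : ∀ {n} {f g : Fin n → ℕ} → (∀ k → f k ≤ g k) → sum f ≤ sum g
∑-mono-≤ {zero}  _   = z≤n
∑-mono-≤ {suc n} f≤g = +-mono-≤ (f≤g zero) (∑-mono-≤ (f≤g ∘ suc))

∑-mono-< : ∀ {n} {f g : Fin n → ℕ} → (∀ k → f k ≤ g k) → ∀ i → f i < g i → sum f < sum g
∑-mono-< f≤g zero    f<g = +-mono-<-≤ f<g (∑-mono-≤ (f≤g ∘ suc))
∑-mono-< f≤g (suc i) f<g = +-mono-≤-< (f≤g zero) (∑-mono-< (f≤g ∘ suc) i f<g)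

∑-differ-at : ∀ {n} {f g : Fin n → ℕ} (i : Fin n) → (∀ k → k ≢ i → f k ≡ g k) →
              sum f + g i ≡ sum g + f i
∑-differ-at {suc n} {f} {g} i f≗g = begin
  sum f + g i                      ≡⟨ cong (_+ g i) (sum-remove f) ⟩
  f i + sum (f ∘ punchIn i) + g i  ≡⟨ cong (λ r → f i + r + g i) (sum-cong-≗ f≗g-off-i) ⟩
  f i + sum (g ∘ punchIn i) + g i  ≡⟨ xy∙z≈zy∙x (f i) _ (g i) ⟩
  g i + sum (g ∘ punchIn i) + f i  ≡⟨ cong (_+ f i) (sum-remove g) ⟨
  sum g + f i                      ∎
  where
  open ≡-Reasoning
  f≗g-off-i : ∀ k → f (punchIn i k) ≡ g (punchIn i k)
  f≗g-off-i k = f≗g (punchIn i k) (punchInᵢ≢i i k)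

∈-removeAt : ∀ {x y : A} {ys} (x∈ys : x ∈ ys) → y ∈ ys → y ≢ x → y ∈ removeAt ys (index x∈ys)
∈-removeAt (here refl)  (here refl)  y≢x = contradiction refl y≢x
∈-removeAt (here refl)  (there y∈ys) _   = y∈ys
∈-removeAt (there x∈ys) (here refl)  _   = here refl
∈-removeAt (there x∈ys) (there y∈ys) y≢x = there (∈-removeAt x∈ys y∈ys y≢x)

Unique-⊆⇒length≤ : ∀ {xs ys : List A} → Unique xs → xs ⊆ ys → length xs ≤ length ys
Unique-⊆⇒length≤ {xs = []}     _            _     = z≤n
Unique-⊆⇒length≤ {xs = x ∷ xs} {ys} (x∉xs ∷ !xs) xs⊆ys = begin
  suc (length xs)                          ≤⟨ s≤s (Unique-⊆⇒length≤ !xs xs⊆ys-x) ⟩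
  suc (length (removeAt ys (index x∈ys)))  ≡⟨ length-removeAt′ ys (index x∈ys) ⟨
  length ys                                ∎
  where
  open ≤-Reasoning
  x∈ys = xs⊆ys (here refl)
  xs⊆ys-x : xs ⊆ removeAt ys (index x∈ys)
  xs⊆ys-x y∈xs = ∈-removeAt x∈ys (xs⊆ys (there y∈xs)) λ { refl → All.lookup x∉xs y∈xs refl }

module _ {P : Pred A p} {Q : Pred A q} (P? : Decidable P) (Q? : Decidable Q) where

  length-filter-disjoint : (∀ {x} → P x → ¬ Q x) → ∀ xs →
                           length (filter P? xs) + length (filter Q? xs) ≤ length xs
  length-filter-disjoint P⇒¬Q []       = z≤n
  length-filter-disjoint P⇒¬Q (x ∷ xs) with ih ← length-filter-disjoint P⇒¬Q xs | P? x | Q? x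
  ... | yes Px | yes Qx = contradiction Qx (P⇒¬Q Px)
  ... | yes _  | no _   = s≤s ih
  ... | no _   | yes _  = subst (_≤ suc (length xs)) (sym (+-suc _ _)) (s≤s ih)
  ... | no _   | no _   = m≤n⇒m≤1+n ih

  length-filter-guard : {G : Set} (G? : Dec G) → P ≐ (λ x → G × Q x) → ∀ xs →
                        length (filter P? xs) ≡ 𝟙 G? * length (filter Q? xs)
  length-filter-guard (yes g) (P⊆ , ⊆P) xs =
    trans (cong length (filter-≐ P? Q? (proj₂ ∘ P⊆ , ⊆P ∘ (g ,_)) xs)) (sym (+-identityʳ _))
  length-filter-guard (no ¬g) (P⊆ , _) xs =
    cong length (filter-none P? {xs} (All.tabulate λ _ → ¬g ∘ proj₁ ∘ P⊆))

length-filter-map : ∀ {P : Pred A p} (P? : Decidable P) (f : A′ → A) xs →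
                    length (filter P? (map f xs)) ≡ length (filter (P? ∘ f) xs)
length-filter-map P? f []       = refl
length-filter-map P? f (x ∷ xs) with does (P? (f x))
... | true  = cong suc (length-filter-map P? f xs)
... | false = length-filter-map P? f xs

length-filter-concatMap-tabulate : ∀ {k} {P : Pred A p} (P? : Decidable P) (g : A′ → List A) (f : Fin k → A′) →
                                   length (filter P? (concatMap g (tabulate f)))
                                     ≡ ∑[ i < k ] length (filter P? (g (f i)))
length-filter-concatMap-tabulate {k = zero}  P? g f = refl
length-filter-concatMap-tabulate {k = suc k} P? g f = begin
  length (filter P? (g x₀ ++ rest))                ≡⟨ cong length (filter-++ P? (g x₀) rest) ⟩
  length (filter P? (g x₀) ++ filter P? rest)      ≡⟨ length-++ (filter P? (g x₀)) ⟩
  length (filter P? (g x₀)) + length (filter P? rest)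
    ≡⟨ cong (length (filter P? (g x₀)) +_) (length-filter-concatMap-tabulate P? g (f ∘ suc)) ⟩
  ∑[ i < suc k ] length (filter P? (g (f i)))      ∎
  where
  open ≡-Reasoning
  x₀ = f zero
  rest = concatMap g (tabulate (f ∘ suc))

module _ (s : ℕ) where

  length-filter-allVecs : ∀ {n} {P : Pred (Vec (Fin s) (suc n)) p} (P? : Decidable P) →
    length (filter P? (allVecs s (suc n))) ≡ ∑[ c < s ] length (filter (P? ∘ (c ∷_)) (allVecs s n))
  length-filter-allVecs {n = n} P? =
    trans (length-filter-concatMap-tabulate P? (λ c → map (c ∷_) (allVecs s n)) id)
          (sum-cong-≗ λ c → length-filter-map P? (c ∷_) (allVecs s n))

  length-allVecs : ∀ n → length (allVecs s n) ≡ s ^ n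
  length-allVecs zero    = refl
  length-allVecs (suc n) =
    trans (length-prefixed (allFin s)) (cong₂ _*_ (length-tabulate {n = s} id) (length-allVecs n))
    where
    V = allVecs s n
    length-prefixed : ∀ cs → length (concatMap (λ c → map (c ∷_) V) cs) ≡ length cs * length V
    length-prefixed []       = refl
    length-prefixed (c ∷ cs) = trans (length-++ (map (c ∷_) V)) (cong₂ _+_ (length-map (c ∷_) V) (length-prefixed cs))

  allVecs-unique : ∀ n → Unique (allVecs s n)
  allVecs-unique zero    = All.[] ∷ []
  allVecs-unique (suc n) = subst Unique (sym (prefixed≡product (allFin s)))
    (cartesianProductWith⁺ _∷_ Vecₚ.∷-injective (allFin⁺ s) (allVecs-unique n))
    where
    V = allVecs s n
    prefixed≡product : ∀ cs → concatMap (λ c → map (c ∷_) V) cs ≡ cartesianProductWith _∷_ cs V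
    prefixed≡product []       = refl
    prefixed≡product (c ∷ cs) = cong (map (c ∷_) V ++_) (prefixed≡product cs)

module _ {s : ℕ} where

  -- Truncated subtraction: meaningful only when 1 ≤ κ u, which the lemmas below assume.
  infixl 20 _─_
  _─_ : (Fin s → ℕ) → Fin s → Fin s → ℕ
  (κ ─ u) c = κ c ∸ 𝟙 (u ≟ c)

  𝟙+─ : ∀ (κ : Fin s → ℕ) u → 1 ≤ κ u → ∀ c → 𝟙 (u ≟ c) + (κ ─ u) c ≡ κ c
  𝟙+─ κ u 1≤κu c = m+[n∸m]≡n 𝟙≤κc
    where
    𝟙≤κc : 𝟙 (u ≟ c) ≤ κ c
    𝟙≤κc with u ≟ c
    ... | yes refl = 1≤κu
    ... | no  _    = z≤n

  ─-other : ∀ (κ : Fin s → ℕ) {u c} → u ≢ c → (κ ─ u) c ≡ κ c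
  ─-other κ {u} {c} u≢c = cong (κ c ∸_) (𝟙-no (u ≟ c) u≢c)

  ─-self : ∀ (κ : Fin s → ℕ) u → (κ ─ u) u ≡ κ u ∸ 1
  ─-self κ u = cong (κ u ∸_) (𝟙-yes (u ≟ u) refl)

  ∑-─ : ∀ (κ : Fin s → ℕ) u → 1 ≤ κ u → suc (sum (κ ─ u)) ≡ sum κ
  ∑-─ κ u 1≤κu = begin
    suc (sum (κ ─ u))                     ≡⟨ cong (_+ sum (κ ─ u)) (∑-indicator u) ⟨
    sum (λ c → 𝟙 (u ≟ c)) + sum (κ ─ u)  ≡⟨ ∑-distrib-+ (λ c → 𝟙 (u ≟ c)) (κ ─ u) ⟨
    sum (λ c → 𝟙 (u ≟ c) + (κ ─ u) c)    ≡⟨ sum-cong-≗ (𝟙+─ κ u 1≤κu) ⟩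
    sum κ                                 ∎
    where open ≡-Reasoning

  κ≤1+κ─u─v : ∀ (κ : Fin s → ℕ) {u v} → u ≢ v → ∀ c → κ c ≤ suc ((κ ─ u ─ v) c)
  κ≤1+κ─u─v κ {u} {v} u≢v c = begin
    κ c                            ≤⟨ m≤n+m∸n (κ c) (δu + δv) ⟩
    (δu + δv) + (κ c ∸ (δu + δv))  ≡⟨ cong ((δu + δv) +_) (∸-+-assoc (κ c) δu δv) ⟨
    (δu + δv) + (κ ─ u ─ v) c      ≤⟨ +-monoˡ-≤ ((κ ─ u ─ v) c) δu+δv≤1 ⟩
    suc ((κ ─ u ─ v) c)            ∎
    where
    open ≤-Reasoning
    δu = 𝟙 (u ≟ c)
    δv = 𝟙 (v ≟ c)
    δu+δv≤1 : δu + δv ≤ 1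
    δu+δv≤1 with u ≟ c | v ≟ c
    ... | yes refl | yes refl = contradiction refl u≢v
    ... | yes _    | no _     = ≤-refl
    ... | no _     | v≟c      = 𝟙≤1 v≟c

∏! : ∀ {s} → (Fin s → ℕ) → ℕ
∏! κ = product (λ c → κ c !)

∏!-nonZero : ∀ {s} (κ : Fin s → ℕ) → NonZero (∏! κ)
∏!-nonZero {zero}  κ = _
∏!-nonZero {suc s} κ = m*n≢0 (κ zero !) (∏! (κ ∘ suc)) {{κ zero !≢0}} {{∏!-nonZero (κ ∘ suc)}}

∏!-─ : ∀ {s} (κ : Fin s → ℕ) u → 1 ≤ κ u → κ u * ∏! (κ ─ u) ≡ ∏! κ
∏!-─ {suc s} κ u 1≤κu = begin
  κ u * ∏! (κ ─ u)                    ≡⟨ cong (κ u *_) (product-remove (λ c → (κ ─ u) c !)) ⟩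
  κ u * ((κ ─ u) u ! * rest′)         ≡⟨ cong₂ (λ a r → κ u * (a ! * r)) (─-self κ u) rest′≡rest ⟩
  κ u * ((κ u ∸ 1) ! * rest)          ≡⟨ *-assoc (κ u) _ rest ⟨
  κ u * (κ u ∸ 1) ! * rest            ≡⟨ cong (_* rest) (n*[n∸1]!≡n! 1≤κu) ⟩
  κ u ! * rest                        ≡⟨ product-remove (λ c → κ c !) ⟨
  ∏! κ                                ∎
  where
  open ≡-Reasoning
  rest  = product (λ k → κ (punchIn u k) !)
  rest′ = product (λ k → (κ ─ u) (punchIn u k) !)
  rest′≡rest : rest′ ≡ rest
  rest′≡rest = product-cong-≗ λ k → cong _! (─-other κ (punchInᵢ≢i u k ∘ sym))
  n*[n∸1]!≡n! : ∀ {n} → 1 ≤ n → n * (n ∸ 1) ! ≡ n !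
  n*[n∸1]!≡n! {suc n} _ = refl

vec-ext : ∀ {n} {x y : Vec A n} → (∀ p → lookup x p ≡ lookup y p) → x ≡ y
vec-ext x≗y = Pointwise.Pointwise-≡⇒≡ (Pointwise.ext x≗y)

module _ {n : ℕ} where

  transpose-matchˡ : (i j : Fin n) → transpose i j i ≡ j
  transpose-matchˡ i j rewrite dec-true (i ≟ i) refl = refl

  transpose-matchʳ : (i j : Fin n) → transpose i j j ≡ i
  transpose-matchʳ i j with j ≟ i
  ... | yes refl = refl
  ... | no  _    rewrite dec-true (j ≟ j) refl = refl

  transpose-mismatch : {i j p : Fin n} → p ≢ i → p ≢ j → transpose i j p ≡ p
  transpose-mismatch {i} {j} {p} p≢i p≢j rewrite dec-false (p ≟ i) p≢i | dec-false (p ≟ j) p≢j = refl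

  data Transposed (i j : Fin n) : Fin n → Fin n → Set where
    at-i  : Transposed i j i j
    at-j  : Transposed i j j i
    fixed : ∀ {p} → p ≢ i → p ≢ j → Transposed i j p p

  transposed : ∀ i j p → Transposed i j p (transpose i j p)
  transposed i j p = view p (p ≟ i) (p ≟ j)
    where
    view : ∀ p → Dec (p ≡ i) → Dec (p ≡ j) → Transposed i j p (transpose i j p)
    view _ (yes refl) _          = subst (Transposed i j i) (sym (transpose-matchˡ i j)) at-i
    view _ (no _)     (yes refl) = subst (Transposed i j j) (sym (transpose-matchʳ i j)) at-j
    view p (no p≢i)   (no p≢j)   =
      subst (Transposed i j p) (sym (transpose-mismatch p≢i p≢j)) (fixed p≢i p≢j)

  transpose-involutive : ∀ i j p → transpose i j (transpose i j p) ≡ p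
  transpose-involutive i j p with transpose i j p | transposed i j p
  ... | _ | at-i          = transpose-matchʳ i j
  ... | _ | at-j          = transpose-matchˡ i j
  ... | _ | fixed p≢i p≢j = transpose-mismatch p≢i p≢j

  swap : Fin n → Fin n → Vec A n → Vec A n
  swap i j x = Vec.tabulate (lookup x ∘ transpose i j)

  lookup-swap : ∀ i j (x : Vec A n) p → lookup (swap i j x) p ≡ lookup x (transpose i j p)
  lookup-swap i j x = Vecₚ.lookup∘tabulate (lookup x ∘ transpose i j)

  lookup-swapˡ : ∀ i j (x : Vec A n) → lookup (swap i j x) i ≡ lookup x j
  lookup-swapˡ i j x = trans (lookup-swap i j x i) (cong (lookup x) (transpose-matchˡ i j))

  lookup-swapʳ : ∀ i j (x : Vec A n) → lookup (swap i j x) j ≡ lookup x i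
  lookup-swapʳ i j x = trans (lookup-swap i j x j) (cong (lookup x) (transpose-matchʳ i j))

  swap-involutive : ∀ i j (x : Vec A n) → swap i j (swap i j x) ≡ x
  swap-involutive i j x = vec-ext λ p → begin
    lookup (swap i j (swap i j x)) p            ≡⟨ lookup-swap i j (swap i j x) p ⟩
    lookup (swap i j x) (transpose i j p)       ≡⟨ lookup-swap i j x (transpose i j p) ⟩
    lookup x (transpose i j (transpose i j p))  ≡⟨ cong (lookup x) (transpose-involutive i j p) ⟩
    lookup x p                                  ∎
    where open ≡-Reasoning

  swap-same : ∀ {i j} {x : Vec A n} → lookup x i ≡ lookup x j → swap i j x ≡ x
  swap-same {i = i} {j} {x} xi≡xj =
    vec-ext λ p → trans (lookup-swap i j x p) (same p (transpose i j p) (transposed i j p))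
    where
    same : ∀ p q → Transposed i j p q → lookup x q ≡ lookup x p
    same _ _ at-i        = sym xi≡xj
    same _ _ at-j        = xi≡xj
    same _ _ (fixed _ _) = refl

-- Restricted slices

module Slice (s : ℕ) where

  Point : ℕ → Set
  Point N = Vec (Fin s) N

  Restriction : ℕ → Set
  Restriction N = Vec (Maybe (Fin s)) N

  private variable
    N : ℕ
    ρ : Restriction N
    κ : Fin s → ℕ
    x y z : Point N
    i j r : Fin N

  Free : Restriction N → Fin N → Set
  Free ρ p = ρ [ p ]= nothing

  Fixed : Restriction N → Pred (Fin N) 0ℓ
  Fixed ρ p = ¬ Free ρ p

  free? : (ρ : Restriction N) → Decidable (Free ρ)
  free? ρ p with lookup ρ p in ρp
  ... | nothing = yes (Vecₚ.lookup⇒[]= p ρ ρp)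
  ... | just _  = no λ fp → contradiction (trans (sym ρp) (Vecₚ.[]=⇒lookup fp)) λ ()

  Agrees : Maybe (Fin s) → Fin s → Set
  Agrees nothing  _ = ⊤
  Agrees (just c) a = a ≡ c

  agrees? : ∀ r a → Dec (Agrees r a)
  agrees? nothing  _ = yes tt
  agrees? (just c) a = a ≟ c

  Extends : Restriction N → Point N → Set
  Extends ρ x = ∀ p → Agrees (lookup ρ p) (lookup x p)

  freeHit : Maybe (Fin s) → Fin s → Fin s → ℕ
  freeHit nothing  a c = 𝟙 (a ≟ c)
  freeHit (just _) _ _ = 0

  freeOcc : Restriction N → Point N → Fin s → ℕ
  freeOcc ρ x c = sum λ p → freeHit (lookup ρ p) (lookup x p) c

  isFree : Maybe (Fin s) → ℕ
  isFree nothing  = 1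
  isFree (just _) = 0

  numFree : Restriction N → ℕ
  numFree ρ = sum λ p → isFree (lookup ρ p)

  record InSlice (ρ : Restriction N) (κ : Fin s → ℕ) (x : Point N) : Set where
    constructor inSlice
    field
      extends : Extends ρ x
      counts  : ∀ c → freeOcc ρ x c ≡ κ c

  inSlice? : (ρ : Restriction N) (κ : Fin s → ℕ) → Decidable (InSlice ρ κ)
  inSlice? ρ κ x = map′ (uncurry inSlice) (λ (inSlice ext occ) → ext , occ)
    (all? (λ p → agrees? (lookup ρ p) (lookup x p)) ×-dec all? (λ c → freeOcc ρ x c ℕ.≟ κ c))

  sliceSize : Restriction N → (Fin s → ℕ) → ℕ
  sliceSize {N} ρ κ = length (filter (inSlice? ρ κ) (allVecs s N))

  sliceSize-≤-cover : ∀ {L : List (Point N)} → (∀ {x} → InSlice ρ κ x → x ∈ L) → sliceSize ρ κ ≤ length L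
  sliceSize-≤-cover {N} {ρ} {κ} cover =
    Unique-⊆⇒length≤ (filter⁺ (inSlice? ρ κ) (allVecs-unique s N))
                     (cover ∘ proj₂ ∘ ∈-filter⁻ (inSlice? ρ κ) {xs = allVecs s N})

  freeOcc-sum : ∀ (ρ : Restriction N) x → sum (freeOcc ρ x) ≡ numFree ρ
  freeOcc-sum ρ x = trans (∑-comm λ c p → freeHit (lookup ρ p) (lookup x p) c)
                          (sum-cong-≗ λ p → hits (lookup ρ p) (lookup x p))
    where
    hits : ∀ r a → sum (freeHit r a) ≡ isFree r
    hits nothing  a = ∑-indicator a
    hits (just _) _ = sum-replicate-zero s

  InSlice⇒sum≡numFree : InSlice ρ κ x → sum κ ≡ numFree ρ
  InSlice⇒sum≡numFree {ρ = ρ} {x = x} (inSlice _ occ) = trans (sum-cong-≗ (sym ∘ occ)) (freeOcc-sum ρ x)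

  InSlice-just : ∀ c₀ c → InSlice (just c₀ ∷ ρ) κ ∘ (c ∷_) ≐ λ y → c₀ ≡ c × InSlice ρ κ y
  InSlice-just c₀ c = (λ (inSlice ext occ) → sym (ext zero) , inSlice (ext ∘ suc) occ)
                    , λ { (refl , inSlice ext occ) → inSlice (λ { zero → refl ; (suc p) → ext p }) occ }

  InSlice-nothing : ∀ c → InSlice (nothing ∷ ρ) κ ∘ (c ∷_) ≐ λ y → 1 ≤ κ c × InSlice ρ (κ ─ c) y
  InSlice-nothing {ρ = ρ} {κ} c = to , from
    where
    to : ∀ {y} → InSlice (nothing ∷ ρ) κ (c ∷ y) → 1 ≤ κ c × InSlice ρ (κ ─ c) y
    to {y} (inSlice ext occ) =
      subst (1 ≤_) (trans (cong (_+ freeOcc ρ y c) (sym (𝟙-yes (c ≟ c) refl))) (occ c)) (s≤s z≤n) ,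
      inSlice (ext ∘ suc) λ c′ → trans (sym (m+n∸m≡n (𝟙 (c ≟ c′)) _)) (cong (_∸ 𝟙 (c ≟ c′)) (occ c′))
    from : ∀ {y} → 1 ≤ κ c × InSlice ρ (κ ─ c) y → InSlice (nothing ∷ ρ) κ (c ∷ y)
    from (1≤κc , inSlice ext occ) = inSlice (λ { zero → tt ; (suc p) → ext p })
                                            λ c′ → trans (cong (𝟙 (c ≟ c′) +_) (occ c′)) (𝟙+─ κ c 1≤κc c′)

  sliceSize-just : ∀ c₀ → sliceSize (just c₀ ∷ ρ) κ ≡ sliceSize ρ κ
  sliceSize-just {N} {ρ} {κ} c₀ = begin
    sliceSize (just c₀ ∷ ρ) κ                        ≡⟨ length-filter-allVecs s (inSlice? (just c₀ ∷ ρ) κ) ⟩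
    ∑[ c < s ] length (filter (P? c) (allVecs s N))  ≡⟨ sum-cong-≗ guard ⟩
    ∑[ c < s ] (𝟙 (c₀ ≟ c) * S)                     ≡⟨ *-distribʳ-sum S (λ c → 𝟙 (c₀ ≟ c)) ⟨
    (∑[ c < s ] 𝟙 (c₀ ≟ c)) * S                     ≡⟨ cong (_* S) (∑-indicator c₀) ⟩
    1 * S                                            ≡⟨ *-identityˡ S ⟩
    S                                                ∎
    where
    open ≡-Reasoning
    S = sliceSize ρ κ
    P? = λ c → inSlice? (just c₀ ∷ ρ) κ ∘ (c ∷_)
    guard : ∀ c → length (filter (P? c) (allVecs s N)) ≡ 𝟙 (c₀ ≟ c) * S
    guard c = length-filter-guard (P? c) (inSlice? ρ κ) (c₀ ≟ c) (InSlice-just c₀ c) (allVecs s N)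

  sliceSize-nothing : sliceSize (nothing ∷ ρ) κ ≡ ∑[ c < s ] (𝟙 (1 ≤? κ c) * sliceSize ρ (κ ─ c))
  sliceSize-nothing {N} {ρ} {κ} = trans (length-filter-allVecs s (inSlice? (nothing ∷ ρ) κ)) (sum-cong-≗ guard)
    where
    P? = λ c → inSlice? (nothing ∷ ρ) κ ∘ (c ∷_)
    guard : ∀ c → length (filter (P? c) (allVecs s N)) ≡ 𝟙 (1 ≤? κ c) * sliceSize ρ (κ ─ c)
    guard c = length-filter-guard (P? c) (inSlice? ρ (κ ─ c)) (1 ≤? κ c) (InSlice-nothing c) (allVecs s N)

  sliceSize-multinomial : ∀ (ρ : Restriction N) κ → sum κ ≡ numFree ρ →
                          sliceSize ρ κ * ∏! κ ≡ numFree ρ !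
  sliceSize-multinomial [] κ ∑κ≡0 = cong₂ _*_ sliceSize≡1 ∏!≡1
    where
    κ≡0 = ∑≡0⇒≡0 κ ∑κ≡0
    sliceSize≡1 : sliceSize [] κ ≡ 1
    sliceSize≡1 = cong length (filter-accept (inSlice? [] κ) (inSlice (λ ()) (sym ∘ κ≡0)))
    ∏!≡1 : ∏! κ ≡ 1
    ∏!≡1 = trans (product-cong-≗ (cong _! ∘ κ≡0)) (product-replicate-one s)
  sliceSize-multinomial (just c₀ ∷ ρ) κ ∑κ≡F =
    trans (cong (_* ∏! κ) (sliceSize-just {ρ = ρ} {κ} c₀)) (sliceSize-multinomial ρ κ ∑κ≡F)
  sliceSize-multinomial (nothing ∷ ρ) κ ∑κ≡1+F = begin
    sliceSize (nothing ∷ ρ) κ * ∏! κ         ≡⟨ cong (_* ∏! κ) (sliceSize-nothing {ρ = ρ} {κ}) ⟩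
    (∑[ c < s ] (𝟙 (1 ≤? κ c) * S c)) * ∏! κ  ≡⟨ *-distribʳ-sum (∏! κ) (λ c → 𝟙 (1 ≤? κ c) * S c) ⟩
    ∑[ c < s ] (𝟙 (1 ≤? κ c) * S c * ∏! κ)    ≡⟨ sum-cong-≗ term ⟩
    ∑[ c < s ] (κ c * numFree ρ !)           ≡⟨ *-distribʳ-sum (numFree ρ !) κ ⟨
    sum κ * numFree ρ !                      ≡⟨ cong (_* numFree ρ !) ∑κ≡1+F ⟩
    suc (numFree ρ) !                        ∎
    where
    open ≡-Reasoning
    S = λ c → sliceSize ρ (κ ─ c)
    term : ∀ c → 𝟙 (1 ≤? κ c) * S c * ∏! κ ≡ κ c * numFree ρ !
    term c with 1 ≤? κ c
    ... | no  κc≱1 = cong (_* numFree ρ !) (sym (n<1⇒n≡0 (≰⇒> κc≱1)))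
    ... | yes 1≤κc = begin
      1 * S c * ∏! κ            ≡⟨ cong₂ _*_ (*-identityˡ (S c)) (sym (∏!-─ κ c 1≤κc)) ⟩
      S c * (κ c * ∏! (κ ─ c))  ≡⟨ x*[y*z]≡y*[x*z] (S c) (κ c) _ ⟩
      κ c * (S c * ∏! (κ ─ c))  ≡⟨ cong (κ c *_) (sliceSize-multinomial ρ (κ ─ c) ∑κ─c≡F) ⟩
      κ c * numFree ρ !          ∎
      where ∑κ─c≡F = suc-injective (trans (∑-─ κ c 1≤κc) ∑κ≡1+F)

  fix : Restriction N → Fin N → Fin s → Restriction N
  fix ρ i u = ρ [ i ]≔ just u

  Free-fix⁺ : ∀ {u} → j ≢ i → Free ρ j → Free (fix ρ i u) j
  Free-fix⁺ {j = j} {i} {ρ} j≢i fj = Vecₚ.[]≔-minimal ρ j i j≢i fj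

  Free-fix⁻ : ∀ {u} → Free (fix ρ i u) j → Free ρ j
  Free-fix⁻ {ρ = ρ} {i} {j = j} fj with j ≟ i
  ... | yes refl = contradiction (Vecₚ.[]=-injective (Vecₚ.[]≔-updates ρ j) fj) λ ()
  ... | no  j≢i  = Vecₚ.lookup⇒[]= j ρ (trans (sym (Vecₚ.lookup∘update′ j≢i ρ _)) (Vecₚ.[]=⇒lookup fj))

  fix-not-free : ∀ {u} → ¬ Free (fix ρ i u) i
  fix-not-free {ρ = ρ} {i} fi = contradiction (Vecₚ.[]=-injective (Vecₚ.[]≔-updates ρ i) fi) λ ()

  Extends-fix⁺ : ∀ {u} → Extends ρ x → lookup x i ≡ u → Extends (fix ρ i u) x
  Extends-fix⁺ {ρ = ρ} {x} {i} {u} ext xi≡u p with p ≟ i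
  ... | yes refl = subst (λ r → Agrees r (lookup x p)) (sym (Vecₚ.lookup∘update p ρ (just u))) xi≡u
  ... | no  p≢i  = subst (λ r → Agrees r (lookup x p)) (sym (Vecₚ.lookup∘update′ p≢i ρ (just u))) (ext p)

  Extends-fix⁻ : ∀ {u} → Free ρ i → Extends (fix ρ i u) x → Extends ρ x × lookup x i ≡ u
  Extends-fix⁻ {ρ = ρ} {i} {x = x} {u} fi ext =
    agrees , subst (λ r → Agrees r (lookup x i)) (Vecₚ.lookup∘update i ρ (just u)) (ext i)
    where
    agrees : Extends ρ x
    agrees p with p ≟ i
    ... | yes refl = subst (λ r → Agrees r (lookup x p)) (sym (Vecₚ.[]=⇒lookup fi)) tt
    ... | no  p≢i  = subst (λ r → Agrees r (lookup x p)) (Vecₚ.lookup∘update′ p≢i ρ (just u)) (ext p)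

  ∑-fix : ∀ {u} (h : Maybe (Fin s) → Fin N → ℕ) → Free ρ i →
          sum (λ p → h (lookup ρ p) p) + h (just u) i ≡ sum (λ p → h (lookup (fix ρ i u) p) p) + h nothing i
  ∑-fix {ρ = ρ} {i} {u} h fi = begin
    Σρ + h (just u) i                ≡⟨ cong (λ r → Σρ + h r i) (Vecₚ.lookup∘update i ρ (just u)) ⟨
    Σρ + h (lookup (fix ρ i u) i) i  ≡⟨ ∑-differ-at i (λ p p≢i → cong (λ r → h r p) (ρ≡ρ′-off-i p≢i)) ⟩
    Σρ′ + h (lookup ρ i) i           ≡⟨ cong (λ r → Σρ′ + h r i) (Vecₚ.[]=⇒lookup fi) ⟩
    Σρ′ + h nothing i                ∎
    where
    open ≡-Reasoning
    Σρ  = sum λ p → h (lookup ρ p) p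
    Σρ′ = sum λ p → h (lookup (fix ρ i u) p) p
    ρ≡ρ′-off-i : ∀ {p} → p ≢ i → lookup ρ p ≡ lookup (fix ρ i u) p
    ρ≡ρ′-off-i p≢i = sym (Vecₚ.lookup∘update′ p≢i ρ (just u))

  freeOcc-fix : ∀ {u} → Free ρ i → ∀ c → freeOcc ρ x c ≡ 𝟙 (lookup x i ≟ c) + freeOcc (fix ρ i u) x c
  freeOcc-fix {ρ = ρ} {i} {x} {u} fi c = trans (sym (+-identityʳ (freeOcc ρ x c)))
    (trans (∑-fix {u = u} (λ r p → freeHit r (lookup x p) c) fi) (+-comm (freeOcc (fix ρ i u) x c) _))

  numFree-fix : ∀ {u} → Free ρ i → numFree ρ ≡ suc (numFree (fix ρ i u))
  numFree-fix {u = u} fi =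
    trans (sym (+-identityʳ _)) (trans (∑-fix {u = u} (λ r _ → isFree r) fi) (+-comm _ 1))

  InSlice-fix⁺ : Free ρ i → InSlice ρ κ x →
                 1 ≤ κ (lookup x i) × InSlice (fix ρ i (lookup x i)) (κ ─ lookup x i) x
  InSlice-fix⁺ {ρ = ρ} {i} {κ} {x} fi (inSlice ext occ) =
    1≤κu , inSlice (Extends-fix⁺ {ρ = ρ} {x} {i} ext refl) occ′
    where
    u = lookup x i
    κ≡ : ∀ c → κ c ≡ 𝟙 (u ≟ c) + freeOcc (fix ρ i u) x c
    κ≡ c = trans (sym (occ c)) (freeOcc-fix {x = x} {u = u} fi c)
    1≤κu : 1 ≤ κ u
    1≤κu = subst (1 ≤_) (sym (trans (κ≡ u) (cong (_+ freeOcc (fix ρ i u) x u) (𝟙-yes (u ≟ u) refl))))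
                 (s≤s z≤n)
    occ′ : ∀ c → freeOcc (fix ρ i u) x c ≡ (κ ─ u) c
    occ′ c = trans (sym (m+n∸m≡n (𝟙 (u ≟ c)) _)) (cong (_∸ 𝟙 (u ≟ c)) (sym (κ≡ c)))

  InSlice-fix⁻ : ∀ {u} → Free ρ i → 1 ≤ κ u → InSlice (fix ρ i u) (κ ─ u) x →
                 InSlice ρ κ x × lookup x i ≡ u
  InSlice-fix⁻ {ρ = ρ} {κ = κ} {x = x} {u = u} fi 1≤κu (inSlice ext occ) with Extends-fix⁻ {x = x} fi ext
  ... | ext′ , refl = inSlice ext′ occ′ , refl
    where
    occ′ : ∀ c → freeOcc ρ x c ≡ κ c
    occ′ c = trans (freeOcc-fix {x = x} {u = u} fi c) (trans (cong (_ +_) (occ c)) (𝟙+─ κ u 1≤κu c))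

  sliceSize-fix : ∀ {u} → Free ρ i → 1 ≤ κ u → sum κ ≡ numFree ρ →
                  sliceSize ρ κ * κ u ≡ numFree ρ * sliceSize (fix ρ i u) (κ ─ u)
  sliceSize-fix {ρ = ρ} {i} {κ} {u} fi 1≤κu ∑κ≡F = *-cancelʳ-≡ _ _ (∏! (κ ─ u)) {{∏!-nonZero (κ ─ u)}} (begin
    S * κ u * ∏! (κ ─ u)       ≡⟨ *-assoc S (κ u) _ ⟩
    S * (κ u * ∏! (κ ─ u))     ≡⟨ cong (S *_) (∏!-─ κ u 1≤κu) ⟩
    S * ∏! κ                   ≡⟨ sliceSize-multinomial ρ κ ∑κ≡F ⟩
    numFree ρ !                ≡⟨ cong _! F≡1+F′ ⟩
    suc F′ * F′ !              ≡⟨ cong₂ _*_ (sym F≡1+F′) (sym (sliceSize-multinomial ρ′ (κ ─ u) ∑κ′≡F′)) ⟩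
    numFree ρ * (S′ * ∏! (κ ─ u))  ≡⟨ *-assoc (numFree ρ) S′ _ ⟨
    numFree ρ * S′ * ∏! (κ ─ u)    ∎)
    where
    open ≡-Reasoning
    ρ′ = fix ρ i u
    F′ = numFree ρ′
    S = sliceSize ρ κ
    S′ = sliceSize ρ′ (κ ─ u)
    F≡1+F′ : numFree ρ ≡ suc F′
    F≡1+F′ = numFree-fix fi
    ∑κ′≡F′ : sum (κ ─ u) ≡ F′
    ∑κ′≡F′ = suc-injective (trans (∑-─ κ u 1≤κu) (trans ∑κ≡F F≡1+F′))

  sliceSize-fix-≤ : ∀ {u} b → Free ρ i → 1 ≤ κ u → sum κ ≡ numFree ρ → numFree ρ ≤ b * κ u →
                    sliceSize ρ κ ≤ b * sliceSize (fix ρ i u) (κ ─ u)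
  sliceSize-fix-≤ {ρ = ρ} {i} {κ} {u} b fi 1≤κu ∑κ≡F F≤bκu =
    *-cancelʳ-≤ _ _ (κ u) {{>-nonZero 1≤κu}} (begin
    sliceSize ρ κ * κ u  ≡⟨ sliceSize-fix fi 1≤κu ∑κ≡F ⟩
    numFree ρ * S′       ≤⟨ *-monoˡ-≤ S′ F≤bκu ⟩
    b * κ u * S′         ≡⟨ x*y*z≡x*z*y b (κ u) S′ ⟩
    b * S′ * κ u         ∎)
    where
    open ≤-Reasoning
    S′ = sliceSize (fix ρ i u) (κ ─ u)

  sliceSize-fix₂-≤ : ∀ b → Free ρ i → Free ρ j → InSlice ρ κ y → lookup y i ≢ lookup y j →
                     (∀ c → 1 ≤ κ c → numFree ρ ≤ b * κ c) →
                     sliceSize ρ κ ≤ b * b * sliceSize (fix (fix ρ i (lookup y i)) j (lookup y j))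
                                                       (κ ─ lookup y i ─ lookup y j)
  sliceSize-fix₂-≤ {ρ = ρ} {i} {j} {κ} {y} b fi fj y∈ u≢v F≤bκ = begin
    sliceSize ρ κ              ≤⟨ sliceSize-fix-≤ b fi 1≤κu (InSlice⇒sum≡numFree y∈) (F≤bκ u 1≤κu) ⟩
    b * sliceSize ρ₁ κ₁        ≤⟨ *-monoʳ-≤ b (sliceSize-fix-≤ b fj₁ 1≤κ₁v (InSlice⇒sum≡numFree y∈₁) F₁≤bκ₁v) ⟩
    b * (b * S₂)               ≡⟨ *-assoc b b S₂ ⟨
    b * b * S₂                 ∎
    where
    open ≤-Reasoning
    u = lookup y i
    v = lookup y j
    ρ₁ = fix ρ i u
    κ₁ = κ ─ u
    S₂ = sliceSize (fix ρ₁ j v) (κ₁ ─ v)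
    fj₁ : Free ρ₁ j
    fj₁ = Free-fix⁺ (λ { refl → u≢v refl }) fj
    1≤κu = proj₁ (InSlice-fix⁺ fi y∈)
    y∈₁ = proj₂ (InSlice-fix⁺ fi y∈)
    1≤κ₁v = proj₁ (InSlice-fix⁺ fj₁ y∈₁)
    κ₁v≡κv = ─-other κ u≢v
    F₁≤bκ₁v : numFree ρ₁ ≤ b * κ₁ v
    F₁≤bκ₁v = begin
      numFree ρ₁        ≤⟨ n≤1+n _ ⟩
      suc (numFree ρ₁)  ≡⟨ numFree-fix fi ⟨
      numFree ρ         ≤⟨ F≤bκ v (subst (1 ≤_) κ₁v≡κv 1≤κ₁v) ⟩
      b * κ v           ≡⟨ cong (b *_) κ₁v≡κv ⟨
      b * κ₁ v          ∎

  restriction-transpose : Free ρ i → Free ρ j → ∀ p → lookup ρ (transpose i j p) ≡ lookup ρ p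
  restriction-transpose {i = i} {j = j} fi fj p with transpose i j p | transposed i j p
  ... | _ | at-i      = trans (Vecₚ.[]=⇒lookup fj) (sym (Vecₚ.[]=⇒lookup fi))
  ... | _ | at-j      = trans (Vecₚ.[]=⇒lookup fi) (sym (Vecₚ.[]=⇒lookup fj))
  ... | _ | fixed _ _ = refl

  InSlice-swap : Free ρ i → Free ρ j → InSlice ρ κ x → InSlice ρ κ (swap i j x)
  InSlice-swap {ρ = ρ} {i} {j} {x = x} fi fj (inSlice ext occ) = inSlice ext′ λ c → trans (occ′ c) (occ c)
    where
    ρ∘τ≗ρ = restriction-transpose fi fj
    ext′ : Extends ρ (swap i j x)
    ext′ p = subst₂ Agrees (ρ∘τ≗ρ p) (sym (lookup-swap i j x p)) (ext (transpose i j p))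
    occ′ : ∀ c → freeOcc ρ (swap i j x) c ≡ freeOcc ρ x c
    occ′ c = begin
      sum (λ p → freeHit (lookup ρ p) (lookup (swap i j x) p) c)
        ≡⟨ sum-cong-≗ (λ p → cong₂ (λ r a → freeHit r a c) (sym (ρ∘τ≗ρ p)) (lookup-swap i j x p)) ⟩
      sum (λ p → f (transpose i j p))  ≡⟨ ∑-permute f (Perm.transpose i j) ⟨
      sum f                            ∎
      where
      open ≡-Reasoning
      f = λ p → freeHit (lookup ρ p) (lookup x p) c

  data SwapStep (ρ : Restriction N) (κ : Fin s → ℕ) : Point N → Point N → Set where
    swap-step : ∀ {y} i j → InSlice ρ κ y → Free ρ i → Free ρ j → SwapStep ρ κ y (swap i j y)

  hamming : Point N → Point N → ℕ
  hamming x z = sum λ p → 𝟙 (¬? (lookup x p ≟ lookup z p))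

  mismatch-free : Extends ρ x → Extends ρ z → lookup x r ≢ lookup z r → Free ρ r
  mismatch-free {ρ = ρ} {r = r} ext-x ext-z xr≢zr with lookup ρ r in ρr | ext-x r | ext-z r
  ... | nothing | _    | _    = Vecₚ.lookup⇒[]= r ρ ρr
  ... | just c  | xr≡c | zr≡c = contradiction (trans xr≡c (sym zr≡c)) xr≢zr

  -- If no such j existed, x would have fewer free occurrences of z_r than z.
  swap-partner : InSlice ρ κ x → InSlice ρ κ z → Free ρ r → lookup x r ≢ lookup z r →
                 ∃ λ j → Free ρ j × lookup x j ≡ lookup z r × lookup z j ≢ lookup z r
  swap-partner {ρ = ρ} {κ} {x} {z} {r} (inSlice _ occ-x) (inSlice _ occ-z) fr xr≢zr
    with any? (λ j → free? ρ j ×-dec (lookup x j ≟ lookup z r) ×-dec ¬? (lookup z j ≟ lookup z r))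
  ... | yes partner = partner
  ... | no  none    = contradiction (trans (occ-x c₀) (sym (occ-z c₀))) (<⇒≢ (∑-mono-< x≤z r x<z))
    where
    c₀ = lookup z r
    x≤z : ∀ p → freeHit (lookup ρ p) (lookup x p) c₀ ≤ freeHit (lookup ρ p) (lookup z p) c₀
    x≤z p with lookup ρ p in ρp
    ... | just _  = z≤n
    ... | nothing with lookup x p ≟ c₀ | lookup z p ≟ c₀
    ...   | no  _  | _      = z≤n
    ...   | yes _  | yes _  = ≤-refl
    ...   | yes xp | no  zp = contradiction (p , Vecₚ.lookup⇒[]= p ρ ρp , xp , zp) none
    x<z : freeHit (lookup ρ r) (lookup x r) c₀ < freeHit (lookup ρ r) (lookup z r) c₀
    x<z rewrite Vecₚ.[]=⇒lookup fr | 𝟙-no (lookup x r ≟ c₀) xr≢zr | 𝟙-yes (c₀ ≟ c₀) refl = s≤s z≤n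

  hamming-swap : ∀ {x z : Point N} {r j} → lookup x r ≢ lookup z r → lookup x j ≡ lookup z r →
                 lookup z j ≢ lookup z r → hamming (swap r j x) z < hamming x z
  hamming-swap {x = x} {z} {r} {j} xr≢zr xj≡zr zj≢zr = ∑-mono-< pointwise r strict
    where
    δ : Fin s → Fin s → ℕ
    δ a b = 𝟙 (¬? (a ≟ b))
    δ-≡ : ∀ {a b} → a ≡ b → δ a b ≡ 0
    δ-≡ {a} {b} a≡b = 𝟙-no (¬? (a ≟ b)) λ a≢b → a≢b a≡b
    δ-≢ : ∀ {a b} → a ≢ b → δ a b ≡ 1
    δ-≢ {a} {b} = 𝟙-yes (¬? (a ≟ b))
    moved : ∀ p q → Transposed r j p q → δ (lookup x q) (lookup z p) ≤ δ (lookup x p) (lookup z p)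
    moved _ _ at-i        = subst (_≤ _) (sym (δ-≡ xj≡zr)) z≤n
    moved _ _ at-j        = subst (δ (lookup x r) (lookup z j) ≤_) (sym (δ-≢ xj≢zj)) (𝟙≤1 _)
      where xj≢zj = λ xj≡zj → zj≢zr (trans (sym xj≡zj) xj≡zr)
    moved _ _ (fixed _ _) = ≤-refl
    pointwise : ∀ p → δ (lookup (swap r j x) p) (lookup z p) ≤ δ (lookup x p) (lookup z p)
    pointwise p = subst (λ a → δ a (lookup z p) ≤ _) (sym (lookup-swap r j x p)) (moved p _ (transposed r j p))
    strict : δ (lookup (swap r j x) r) (lookup z r) < δ (lookup x r) (lookup z r)
    strict rewrite lookup-swapˡ r j x | δ-≡ xj≡zr | δ-≢ xr≢zr = s≤s z≤n

  slice-connected : InSlice ρ κ x → InSlice ρ κ z → Star (SwapStep ρ κ) x z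
  slice-connected {ρ = ρ} {κ} {x} {z} x∈ z∈ = go (<-wellFounded (hamming x z)) x∈
    where
    go : ∀ {x} → Acc _<_ (hamming x z) → InSlice ρ κ x → Star (SwapStep ρ κ) x z
    go {x} (acc closer) x∈ with any? (λ p → ¬? (lookup x p ≟ lookup z p))
    ... | no  ¬mismatch = subst (Star (SwapStep ρ κ) x) x≡z Star.ε
      where x≡z = vec-ext λ p → decidable-stable (lookup x p ≟ lookup z p) λ xp≢zp → ¬mismatch (p , xp≢zp)
    ... | yes (r , xr≢zr) with mismatch-free {x = x} {z = z} (InSlice.extends x∈) (InSlice.extends z∈) xr≢zr
    ...   | fr with swap-partner x∈ z∈ fr xr≢zr
    ...     | j , fj , xj≡zr , zj≢zr =
      swap-step r j x∈ fr fj ◅ go (closer (hamming-swap {x = x} {z} xr≢zr xj≡zr zj≢zr)) (InSlice-swap fr fj x∈)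

  Pinned : Fin N → Fin N → Fin s → Fin s → Point N → Set
  Pinned i j u v x = lookup x i ≡ u × lookup x j ≡ v

  pinned? : ∀ (i j : Fin N) u v → Decidable (Pinned i j u v)
  pinned? i j u v x = (lookup x i ≟ u) ×-dec (lookup x j ≟ v)

  pinnedPart : Fin N → Fin N → Fin s → Fin s → List (Point N) → List (Point N)
  pinnedPart i j u v L = filter (pinned? i j u v) L ++ map (swap i j) (filter (pinned? i j v u) L)

  length-pinnedPart : ∀ {u v} (L : List (Point N)) → u ≢ v → length (pinnedPart i j u v L) ≤ length L
  length-pinnedPart {i = i} {j} {u} {v} L u≢v = begin
    length (filter uv L ++ map (swap i j) (filter vu L))          ≡⟨ length-++ (filter uv L) ⟩
    length (filter uv L) + length (map (swap i j) (filter vu L))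
      ≡⟨ cong (length (filter uv L) +_) (length-map (swap i j) (filter vu L)) ⟩
    length (filter uv L) + length (filter vu L)
      ≤⟨ length-filter-disjoint uv vu (λ {x} → disjoint {x}) L ⟩
    length L                                                      ∎
    where
    open ≤-Reasoning
    uv = pinned? i j u v
    vu = pinned? i j v u
    disjoint : ∀ {x} → Pinned i j u v x → ¬ Pinned i j v u x
    disjoint {x} (xi≡u , _) (xi≡v , _) = u≢v (trans (sym xi≡u) xi≡v)

  ∈-pinnedPart : ∀ {u v L} → Pinned i j u v x → x ∈ L ⊎ swap i j x ∈ L → x ∈ pinnedPart i j u v L
  ∈-pinnedPart {i = i} {j} {x} {u} {v} {L} pin (inj₁ x∈L) = ∈-++⁺ˡ (∈-filter⁺ (pinned? i j u v) x∈L pin)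
  ∈-pinnedPart {i = i} {j} {x} {u} {v} {L} (xi≡u , xj≡v) (inj₂ sx∈L) =
    ∈-++⁺ʳ (filter (pinned? i j u v) L) (subst (_∈ map (swap i j) _) (swap-involutive i j x)
      (∈-map⁺ (swap i j) (∈-filter⁺ (pinned? i j v u) sx∈L sx-pinned)))
    where
    sx-pinned : Pinned i j v u (swap i j x)
    sx-pinned = trans (lookup-swapˡ i j x) xj≡v , trans (lookup-swapʳ i j x) xi≡u

  allFree : Restriction N
  allFree {N} = Vec.replicate N nothing

  freeOcc-allFree : ∀ (x : Point N) c → freeOcc allFree x c ≡ occ c x
  freeOcc-allFree []      c = refl
  freeOcc-allFree (a ∷ x) c with a ≟ c
  ... | yes _ = cong suc (freeOcc-allFree x c)
  ... | no  _ = freeOcc-allFree x c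

-- Juntas over a set of coordinates

module Junta {c ℓ} (G : AbelianGroup c ℓ) (s : ℕ) {N : ℕ} where

  open AbelianGroup G renaming (refl to ≈-refl; sym to ≈-sym; trans to ≈-trans)
  open import Algebra.Properties.Group group using (ε⁻¹≈ε)
  open import Algebra.Properties.AbelianGroup G using (⁻¹-∙-comm)
  open import Algebra.Properties.CommutativeSemigroup commutativeSemigroup using (interchange)
  open Slice s using (Point)

  DependsOn : Pred (Fin N) 0ℓ → (Point N → Carrier) → Set ℓ
  DependsOn S f = ∀ x y → (∀ p → S p → lookup x p ≡ lookup y p) → f x ≈ f y

  -- Only dependence outside K counts towards the degree; K will be the fixed coordinates of a restriction.
  IsJuntaOver : Pred (Fin N) 0ℓ → ℕ → (Point N → Carrier) → Set ℓ
  IsJuntaOver K e f = Σ (List (Fin N)) λ T → length T ≤ e × DependsOn (λ p → p ∈ T ⊎ K p) f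

  sumAt : List (Point N → Carrier) → Point N → Carrier
  sumAt fs x = gsum G (map (λ f → f x) fs)

  InJOver : Pred (Fin N) 0ℓ → ℕ → (Point N → Carrier) → Set (c ⊔ ℓ)
  InJOver K e P = Σ (List (Point N → Carrier)) λ fs →
    (∀ f → f ∈ fs → IsJuntaOver K e f) × (∀ x → P x ≈ sumAt fs x)

  InJ⇒InJOver : ∀ {d P} K → InJ G d P → InJOver K d P
  InJ⇒InJOver K (fs , juntas , P≈) = fs , (λ f f∈fs → over (juntas f f∈fs)) , P≈
    where
    over : ∀ {d f} → IsJunta G d f → IsJuntaOver K d f
    over (T , |T|≤d , dep) = T , |T|≤d , λ x y agree → dep x y λ p p∈T → agree p (inj₁ p∈T)

  sumAt-cong : ∀ fs {x y} → (∀ {f} → f ∈ fs → f x ≈ f y) → sumAt fs x ≈ sumAt fs y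
  sumAt-cong []       _     = ≈-refl
  sumAt-cong (f ∷ fs) fx≈fy = ∙-cong (fx≈fy (here refl)) (sumAt-cong fs (fx≈fy ∘ there))

  swap-invariant : ∀ {S f i j} → DependsOn S f → ¬ S i → ¬ S j → ∀ x → f (swap i j x) ≈ f x
  swap-invariant {i = i} {j} dep ¬Si ¬Sj x = dep (swap i j x) x λ p Sp →
    trans (lookup-swap i j x p) (cong (lookup x) (transpose-mismatch (λ { refl → ¬Si Sp }) (λ { refl → ¬Sj Sp })))

  InJOver-swap-invariant : ∀ {K P i j} → InJOver K 0 P → ¬ K i → ¬ K j → ∀ x → P (swap i j x) ≈ P x
  InJOver-swap-invariant {K} {P} {i} {j} (fs , juntas , P≈) ¬Ki ¬Kj x =
    ≈-trans (P≈ (swap i j x)) (≈-trans (sumAt-cong fs λ {f} f∈fs → invariant (juntas f f∈fs)) (≈-sym (P≈ x)))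
    where
    invariant : ∀ {f} → IsJuntaOver K 0 f → f (swap i j x) ≈ f x
    invariant ([] , _ , dep) = swap-invariant dep [ (λ ()) , ¬Ki ] [ (λ ()) , ¬Kj ] x

  Δ : Fin N → Fin N → (Point N → Carrier) → Point N → Carrier
  Δ i j f x = f x ∙ f (swap i j x) ⁻¹

  sumAt-Δ : ∀ {i j} fs x → sumAt (map (Δ i j) fs) x ≈ Δ i j (sumAt fs) x
  sumAt-Δ         []       x = ≈-sym (≈-trans (∙-congˡ ε⁻¹≈ε) (identityʳ ε))
  sumAt-Δ {i} {j} (f ∷ fs) x = ≈-trans (∙-congˡ (sumAt-Δ fs x))
    (≈-trans (interchange (f x) (f (swap i j x) ⁻¹) (sumAt fs x) (sumAt fs (swap i j x) ⁻¹))
             (∙-congˡ (⁻¹-∙-comm (f (swap i j x)) (sumAt fs (swap i j x)))))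

  OneOf : Fin N → Fin N → Pred (Fin N) 0ℓ
  OneOf i j p = p ≡ i ⊎ p ≡ j

  oneOf? : ∀ i j → Decidable (OneOf i j)
  oneOf? i j p = (p ≟ i) ⊎-dec (p ≟ j)

  IsJuntaOver-Δ : ∀ {K K′ : Pred (Fin N) 0ℓ} {e f i j} → ¬ K i → ¬ K j → (∀ {p} → K p → K′ p) → K′ i → K′ j →
                  IsJuntaOver K (suc e) f → IsJuntaOver K′ e (Δ i j f)
  IsJuntaOver-Δ {K} {K′} {e} {f} {i} {j} ¬Ki ¬Kj K⊆K′ K′i K′j (T , |T|≤1+e , dep) with Any.any? (oneOf? i j) T
  ... | no  T∌i,j = [] , z≤n , λ x y _ → ≈-trans (Δ≈ε x) (≈-sym (Δ≈ε y))
    where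
    ¬S : ∀ {q} → OneOf i j q → ¬ (q ∈ T ⊎ K q)
    ¬S {q} q∈ij = [ (λ q∈T → T∌i,j (Any.map (λ { refl → q∈ij }) q∈T))
                  , (λ Kq → [ (λ { refl → ¬Ki Kq }) , (λ { refl → ¬Kj Kq }) ] q∈ij) ]
    Δ≈ε : ∀ x → Δ i j f x ≈ ε
    Δ≈ε x = ≈-trans (∙-congˡ (⁻¹-cong (swap-invariant dep (¬S (inj₁ refl)) (¬S (inj₂ refl)) x))) (inverseʳ (f x))
  ... | yes T∋i,j = T′ , |T′|≤e , λ x y agree → Δ-depends x y λ p Up → agree p (U⊆T′∪K′ Up)
    where
    T′ = filter (¬? ∘ oneOf? i j) T
    |T′|≤e : length T′ ≤ e
    |T′|≤e = ≤-pred (≤-trans (filter-notAll (¬? ∘ oneOf? i j) T (Any.map (λ h ¬h → ¬h h) T∋i,j)) |T|≤1+e)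
    U : Pred (Fin N) 0ℓ
    U p = (p ∈ T ⊎ K p) ⊎ OneOf i j p
    U-closed : ∀ {p} → U p → U (transpose i j p)
    U-closed {p} Up with transpose i j p | transposed i j p
    ... | _ | at-i      = inj₂ (inj₂ refl)
    ... | _ | at-j      = inj₂ (inj₁ refl)
    ... | _ | fixed _ _ = Up
    f-depends : DependsOn U f
    f-depends x y agree = dep x y λ p S → agree p (inj₁ S)
    Δ-depends : DependsOn U (Δ i j f)
    Δ-depends x y agree = ∙-cong (f-depends x y agree) (⁻¹-cong (f-depends _ _ λ p Up →
      trans (lookup-swap i j x p) (trans (agree _ (U-closed Up)) (sym (lookup-swap i j y p)))))
    U⊆T′∪K′ : ∀ {p} → U p → p ∈ T′ ⊎ K′ p
    U⊆T′∪K′ {p} (inj₁ (inj₁ p∈T)) with oneOf? i j p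
    ... | yes (inj₁ refl) = inj₂ K′i
    ... | yes (inj₂ refl) = inj₂ K′j
    ... | no  p∉ij        = inj₁ (∈-filter⁺ (¬? ∘ oneOf? i j) p∈T p∉ij)
    U⊆T′∪K′ (inj₁ (inj₂ Kp))   = inj₂ (K⊆K′ Kp)
    U⊆T′∪K′ (inj₂ (inj₁ refl)) = inj₂ K′i
    U⊆T′∪K′ (inj₂ (inj₂ refl)) = inj₂ K′j

  InJOver-Δ : ∀ {K K′ : Pred (Fin N) 0ℓ} {e P i j} → ¬ K i → ¬ K j → (∀ {p} → K p → K′ p) → K′ i → K′ j →
              InJOver K (suc e) P → InJOver K′ e (Δ i j P)
  InJOver-Δ {i = i} {j} ¬Ki ¬Kj K⊆K′ K′i K′j (fs , juntas , P≈) = map (Δ i j) fs , juntas′ ,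
    λ x → ≈-trans (∙-cong (P≈ x) (⁻¹-cong (P≈ (swap i j x)))) (≈-sym (sumAt-Δ fs x))
    where
    juntas′ : ∀ g → g ∈ map (Δ i j) fs → IsJuntaOver _ _ g
    juntas′ g g∈ with ∈-map⁻ (Δ i j) g∈
    ... | f , f∈fs , refl = IsJuntaOver-Δ ¬Ki ¬Kj K⊆K′ K′i K′j (juntas f f∈fs)

-- The counting argument

module Main {c ℓ} (G : AbelianGroup c ℓ) (s m d : ℕ) .{{_ : NonZero s}} {N : ℕ} where

  open AbelianGroup G using (Carrier; _≈_; ε; ∙-cong; ∙-congˡ; ⁻¹-cong; identityʳ)
    renaming (refl to ≈-refl; sym to ≈-sym; trans to ≈-trans; reflexive to ≈-reflexive)
  open import Algebra.Properties.Group (AbelianGroup.group G) using (ε⁻¹≈ε; x∙y⁻¹≈ε⇒x≈y)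
  open Slice s
  open Junta G s {N} using (InJOver; InJOver-swap-invariant; Δ; InJOver-Δ)

  B : ℕ
  B = s * d

  bound : ℕ → ℕ
  bound e = (B * B) ^ e

  1≤bound : ∀ {e} → e ≤ d → 1 ≤ bound e
  1≤bound {zero}  _     = ≤-refl
  1≤bound {suc e} 1+e≤d = m^n>0 (B * B) (suc e)
    where
    instance
      d≢0 : NonZero d
      d≢0 = >-nonZero (≤-trans (s≤s z≤n) 1+e≤d)
      B≢0 : NonZero B
      B≢0 = m*n≢0 s d
      B*B≢0 : NonZero (B * B)
      B*B≢0 = m*n≢0 B B

  -- The induction invariant, once t pairs of coordinates of the m-balanced slice are fixed:
  -- every symbol keeps at least m ∸ t free occurrences.
  Admissible : ℕ → (Fin s → ℕ) → Set
  Admissible t κ = (∀ c → m ≤ κ c + t) × sum κ ≤ s * m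

  Admissible-fix₂ : ∀ {t κ u v} → Admissible t κ → u ≢ v → Admissible (suc t) (κ ─ u ─ v)
  Admissible-fix₂ {t} {κ} {u} {v} (m≤κ+t , ∑κ≤sm) u≢v = m≤κ′+1+t , ≤-trans ∑κ′≤∑κ ∑κ≤sm
    where
    m≤κ′+1+t : ∀ c → m ≤ (κ ─ u ─ v) c + suc t
    m≤κ′+1+t c = ≤-trans (m≤κ+t c) (subst (κ c + t ≤_) (sym (+-suc _ t)) (+-monoˡ-≤ t (κ≤1+κ─u─v κ u≢v c)))
    ∑κ′≤∑κ : sum (κ ─ u ─ v) ≤ sum κ
    ∑κ′≤∑κ = ∑-mono-≤ {f = κ ─ u ─ v} {κ} λ c → ≤-trans (m∸n≤m _ (𝟙 (v ≟ c))) (m∸n≤m (κ c) (𝟙 (u ≟ c)))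

  numFree-≤ : ∀ {t ρ κ} {y : Point N} → Admissible t κ → suc t ≤ d → InSlice ρ κ y →
              ∀ c → 1 ≤ κ c → numFree ρ ≤ B * κ c
  numFree-≤ {t} {ρ} {κ} (m≤κ+t , ∑κ≤sm) 1+t≤d y∈ c 1≤κc = begin
    numFree ρ      ≡⟨ InSlice⇒sum≡numFree y∈ ⟨
    sum κ          ≤⟨ ∑κ≤sm ⟩
    s * m          ≤⟨ *-monoʳ-≤ s m≤dκc ⟩
    s * (d * κ c)  ≡⟨ *-assoc s d (κ c) ⟨
    B * κ c        ∎
    where
    open ≤-Reasoning
    m≤dκc : m ≤ d * κ c
    m≤dκc = begin
      m            ≤⟨ m≤κ+t c ⟩
      κ c + t      ≤⟨ +-monoʳ-≤ (κ c) (m≤m*n t (κ c) {{>-nonZero 1≤κc}}) ⟩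
      suc t * κ c  ≤⟨ *-monoˡ-≤ (κ c) 1+t≤d ⟩
      d * κ c      ∎

  Covers : Restriction N → (Fin s → ℕ) → (Point N → Carrier) → List (Point N) → Set ℓ
  Covers ρ κ P L = ∀ {x} → InSlice ρ κ x → ¬ P x ≈ ε → x ∈ L

  Covers-Δ : ∀ {ρ κ P L i j u v} → Free ρ i → Free ρ j → j ≢ i → 1 ≤ κ u → 1 ≤ (κ ─ u) v → Covers ρ κ P L →
             Covers (fix (fix ρ i u) j v) (κ ─ u ─ v) (Δ i j P) (pinnedPart i j u v L)
  Covers-Δ {ρ} {κ} {P} {L} {i} {j} {u} {v} fi fj j≢i 1≤κu 1≤κ₁v cover {x} x∈′ Δx≉ε
    with InSlice-fix⁻ (Free-fix⁺ j≢i fj) 1≤κ₁v x∈′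
  ... | x∈₁ , xj≡v with InSlice-fix⁻ fi 1≤κu x∈₁
  ... | x∈ , xi≡u = decidable-stable (x ∈? pinnedPart i j u v L) λ x∉ →
    x∉ (∈-pinnedPart (xi≡u , xj≡v) (inj₁ (cover x∈ λ Px≈ε →
    x∉ (∈-pinnedPart (xi≡u , xj≡v) (inj₂ (cover (InSlice-swap fi fj x∈) λ Psx≈ε → Δx≉ε (Δ≈ε Px≈ε Psx≈ε)))))))
    where
    _∈?_ = DecMembership._∈?_ (Vecₚ.≡-dec _≟_)
    Δ≈ε : P x ≈ ε → P (swap i j x) ≈ ε → Δ i j P x ≈ ε
    Δ≈ε Px≈ε Psx≈ε = ≈-trans (∙-cong Px≈ε (⁻¹-cong Psx≈ε)) (≈-trans (∙-congˡ ε⁻¹≈ε) (identityʳ ε))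

  -- If P separates no point from its free transpositions then, the slice being connected by
  -- them, P is (up to double negation) constant, hence nowhere zero, on the slice.
  slice-bound-unless-separated : ∀ {e ρ κ P L} {a : Point N} →
    1 ≤ bound e → InSlice ρ κ a → ¬ P a ≈ ε → Covers ρ κ P L →
    (∀ {y i j} → InSlice ρ κ y → Free ρ i → Free ρ j → ¬ P y ≈ P (swap i j y) → sliceSize ρ κ ≤ bound e * length L) →
    sliceSize ρ κ ≤ bound e * length L
  slice-bound-unless-separated {e} {ρ} {κ} {P} {L} 1≤bound a∈ Pa≉ε cover separated =
    decidable-stable (sliceSize ρ κ ≤? bound e * length L) λ ¬bound →
      let related : ∀ {x z} → Star (SwapStep ρ κ) x z → ¬ ¬ P x ≈ P z
          related = Star.fold (λ x z → ¬ ¬ P x ≈ P z)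
            (λ { (swap-step i j y∈ fi fj) ¬¬Psy≈Pz ¬Py≈Pz → ¬¬Psy≈Pz λ Psy≈Pz →
                   ¬bound (separated y∈ fi fj λ Py≈Psy → ¬Py≈Pz (≈-trans Py≈Psy Psy≈Pz)) })
            (λ ¬Px≈Px → ¬Px≈Px ≈-refl)
          nonzero : ∀ {z} → InSlice ρ κ z → ¬ P z ≈ ε
          nonzero z∈ Pz≈ε = related (slice-connected a∈ z∈) λ Pa≈Pz → Pa≉ε (≈-trans Pa≈Pz Pz≈ε)
      in ¬bound (≤-trans (sliceSize-≤-cover λ x∈ → cover x∈ (nonzero x∈))
                         (m≤n*m (length L) (bound e) {{>-nonZero 1≤bound}}))

  mutual
    slice-bound : ∀ e {t ρ κ P L} {a : Point N} → InJOver (Fixed ρ) e P → e + t ≤ d → Admissible t κ →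
                  InSlice ρ κ a → ¬ P a ≈ ε → Covers ρ κ P L → sliceSize ρ κ ≤ bound e * length L
    slice-bound zero    P∈J _     _   a∈ Pa≉ε cover = slice-bound-unless-separated {e = 0} ≤-refl a∈ Pa≉ε cover
      λ _ fi fj Py≉Psy → contradiction (≈-sym (InJOver-swap-invariant P∈J (λ ¬fi → ¬fi fi) (λ ¬fj → ¬fj fj) _)) Py≉Psy
    slice-bound (suc e) P∈J stage adm a∈ Pa≉ε cover =
      slice-bound-unless-separated {e = suc e} (1≤bound (m+n≤o⇒m≤o (suc e) stage)) a∈ Pa≉ε cover
        (slice-bound-separated e P∈J stage adm cover)

    slice-bound-separated : ∀ e {t ρ κ P L} {y : Point N} {i j} → InJOver (Fixed ρ) (suc e) P → suc e + t ≤ d →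
                            Admissible t κ → Covers ρ κ P L → InSlice ρ κ y → Free ρ i → Free ρ j →
                            ¬ P y ≈ P (swap i j y) → sliceSize ρ κ ≤ bound (suc e) * length L
    slice-bound-separated e {t} {ρ} {κ} {P} {L} {y} {i} {j} P∈J stage adm cover y∈ fi fj Py≉Psy = begin
      sliceSize ρ κ                     ≤⟨ sliceSize-fix₂-≤ B fi fj y∈ u≢v (numFree-≤ adm 1+t≤d y∈) ⟩
      B * B * sliceSize ρ′ (κ ─ u ─ v)  ≤⟨ *-monoʳ-≤ (B * B) (slice-bound e Δ∈J stage′ adm′ y∈′ Δy≉ε cover′) ⟩
      B * B * (bound e * length L′)     ≤⟨ *-monoʳ-≤ (B * B) (*-monoʳ-≤ (bound e) (length-pinnedPart L u≢v)) ⟩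
      B * B * (bound e * length L)      ≡⟨ *-assoc (B * B) (bound e) (length L) ⟨
      bound (suc e) * length L          ∎
      where
      open ≤-Reasoning
      u = lookup y i
      v = lookup y j
      u≢v : u ≢ v
      u≢v u≡v = Py≉Psy (≈-reflexive (cong P (sym (swap-same u≡v))))
      j≢i : j ≢ i
      j≢i refl = u≢v refl
      1+t≤d : suc t ≤ d
      1+t≤d = ≤-trans (s≤s (m≤n+m t e)) stage
      stage′ : e + suc t ≤ d
      stage′ = subst (_≤ d) (sym (+-suc e t)) stage
      adm′ = Admissible-fix₂ adm u≢v
      ρ′ = fix (fix ρ i u) j v
      L′ = pinnedPart i j u v L
      fj₁ = Free-fix⁺ j≢i fj
      y∈₁ = proj₂ (InSlice-fix⁺ fi y∈)
      y∈′ = proj₂ (InSlice-fix⁺ fj₁ y∈₁)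
      cover′ : Covers ρ′ (κ ─ u ─ v) (Δ i j P) L′
      cover′ = Covers-Δ fi fj j≢i (proj₁ (InSlice-fix⁺ fi y∈)) (proj₁ (InSlice-fix⁺ fj₁ y∈₁)) cover
      Δ∈J : InJOver (Fixed ρ′) e (Δ i j P)
      Δ∈J = InJOver-Δ (λ ¬fi → ¬fi fi) (λ ¬fj → ¬fj fj) (λ ¬fp fp′ → ¬fp (Free-fix⁻ (Free-fix⁻ fp′)))
                      (λ fi′ → fix-not-free (Free-fix⁻ fi′)) fix-not-free P∈J
      Δy≉ε : ¬ Δ i j P y ≈ ε
      Δy≉ε Δy≈ε = Py≉Psy (x∙y⁻¹≈ε⇒x≈y _ _ Δy≈ε)

module BalancedSlice (s n m : ℕ) .{{_ : NonZero s}} (n≡m*s : n ≡ m * s) where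
  open Slice s

  InSlice⇒Balanced : ∀ {x : Point n} → InSlice allFree (λ _ → m) x → Balanced x
  InSlice⇒Balanced {x} (inSlice _ counts) c = begin
    s * occ c x  ≡⟨ cong (s *_) (trans (sym (freeOcc-allFree x c)) (counts c)) ⟩
    s * m        ≡⟨ *-comm s m ⟩
    m * s        ≡⟨ n≡m*s ⟨
    n            ∎
    where open ≡-Reasoning

  Balanced⇒InSlice : ∀ {x : Point n} → Balanced x → InSlice allFree (λ _ → m) x
  Balanced⇒InSlice {x} bal = inSlice ext λ c → trans (freeOcc-allFree x c) (*-cancelˡ-≡ _ _ s (trans (bal c) n≡s*m))
    where
    ext : Extends allFree x
    ext p = subst (λ r → Agrees r (lookup x p)) (sym (Vecₚ.lookup-replicate p nothing)) tt
    n≡s*m = trans n≡m*s (*-comm m s)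

  length-slice : length (slice s n) ≡ sliceSize (allFree {n}) (λ _ → m)
  length-slice = cong length
    (filter-≐ balanced? (inSlice? allFree (λ _ → m)) (Balanced⇒InSlice , InSlice⇒Balanced) (allVecs s n))

length-slice-≤1 : ∀ {s} n → s ≤ 1 → length (slice s n) ≤ 1
length-slice-≤1 {s} n s≤1 = begin
  length (slice s n)    ≤⟨ length-filter balanced? (allVecs s n) ⟩
  length (allVecs s n)  ≡⟨ length-allVecs s n ⟩
  s ^ n                 ≤⟨ ^-monoˡ-≤ n s≤1 ⟩
  1 ^ n                 ≡⟨ ^-zeroˡ n ⟩
  1                     ∎
  where open ≤-Reasoning

1≤n^n : ∀ n → 1 ≤ n ^ n
1≤n^n zero    = ≤-refl
1≤n^n (suc n) = m^n>0 (suc n) (suc n)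

[B*B]^d≤B^B : ∀ {s} d → 2 ≤ s → (s * d * (s * d)) ^ d ≤ (s * d) ^ (s * d)
[B*B]^d≤B^B {s} zero      _   = 1≤n^n (s * 0)
[B*B]^d≤B^B {s} d@(suc _) 2≤s = begin
  (B * B) ^ d  ≡⟨ cong (λ b → (B * b) ^ d) (*-identityʳ B) ⟨
  (B ^ 2) ^ d  ≡⟨ ^-*-assoc B 2 d ⟩
  B ^ (2 * d)  ≤⟨ ^-monoʳ-≤ B (*-monoˡ-≤ d 2≤s) ⟩
  B ^ (s * d)  ∎
  where
  open ≤-Reasoning
  B = s * d
  instance
    B≢0 : NonZero B
    B≢0 = m*n≢0 s d {{>-nonZero (≤-trans (s≤s z≤n) 2≤s)}}

corollary5p11 : {c ℓ : Level} (n s d : ℕ) → s * d ≤ n → s ∣ n →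
    (G : AbelianGroup c ℓ) → (P : Vec (Fin s) n → AbelianGroup.Carrier G) →
    InJ G d P →
    Σ (Vec (Fin s) n) (λ a → Balanced a × ¬ (AbelianGroup._≈_ G (P a) (AbelianGroup.ε G))) →
    (L : List (Vec (Fin s) n)) → Unique L →
    ((x : Vec (Fin s) n) → x ∈ L → Balanced x) →
    ((x : Vec (Fin s) n) → Balanced x → ¬ (AbelianGroup._≈_ G (P x) (AbelianGroup.ε G)) → x ∈ L) →
    length (slice s n) ≤ (s * d) ^ (s * d) * length L
corollary5p11 n s d _ (divides m n≡m*s) G P P∈J (a , a-bal , Pa≉ε) L _ _ cover with s ≤? 1
... | yes s≤1 = ≤-trans (length-slice-≤1 n s≤1) (*-mono-≤ (1≤n^n (s * d)) (∈-length (cover a a-bal Pa≉ε)))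
... | no  s≰1 = begin
  length (slice s n)                ≡⟨ length-slice ⟩
  sliceSize (allFree {n}) (λ _ → m) ≤⟨ slice-bound d P∈J′ (≤-reflexive (+-identityʳ d)) admissible a∈ Pa≉ε cover′ ⟩
  bound d * length L                ≤⟨ *-monoˡ-≤ (length L) ([B*B]^d≤B^B d 2≤s) ⟩
  (s * d) ^ (s * d) * length L      ∎
  where
  open ≤-Reasoning
  2≤s = ≰⇒> s≰1
  instance
    s≢0 : NonZero s
    s≢0 = >-nonZero (≤-trans (s≤s z≤n) 2≤s)
  open Slice s
  open Junta G s {n} using (InJ⇒InJOver)
  open Main G s m d {n}
  open BalancedSlice s n m n≡m*s
  P∈J′ = InJ⇒InJOver (Fixed allFree) P∈J
  admissible : Admissible 0 (λ _ → m)
  admissible = (λ _ → ≤-reflexive (sym (+-identityʳ m))) , ≤-reflexive (∑-const s m)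
  a∈ = Balanced⇒InSlice a-bal
  cover′ : Covers allFree (λ _ → m) P L
  cover′ x∈ = cover _ (InSlice⇒Balanced x∈)
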